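{- Let $D$ be a unicyclic bipartite graph with a unique perfect matching and exactly two pegs $\rho_1$ and $\rho_2$. Then for any two vertices $u,v$ of $D$, if there are two co-augmenting paths from $u$ to $v$, then $\rho_1$ and $\rho_2$ are edges of both of these paths.
   Context: A unicyclic graph is a connected graph containing exactly one cycle. Let $\mathcal{M}$ be the unique perfect matching. A peg is an edge of $\mathcal{M}$ that is not an edge of the cycle but is incident to a vertex of the cycle. A path is co-augmenting if its edges alternate between edges of $\mathcal{M}$ and edges not in $\mathcal{M}$, with the first and last edges in $\mathcal{M}$. -}

module Defs where

open import Data.Nat using (ℕ; _≤_)
open import Data.Fin using (Fin)
open import Data.List using (List; []; _∷_; _++_; length)
open import Data.List.Membership.Propositional using (_∈_)
open import Data.List.Relation.Unary.Unique.Propositional using (Unique)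
open import Data.Product using (Σ; ∃; _×_)
open import Data.Sum using (_⊎_)
open import Data.Empty using (⊥)
open import Relation.Nullary using (¬_)
open import Relation.Binary.PropositionalEquality using (_≡_)

record Graph (n : ℕ) : Set₁ where
  field
    Adj       : Fin n → Fin n → Set
    Adj-sym   : ∀ {x y} → Adj x y → Adj y x
    Adj-irrefl : ∀ {x} → ¬ Adj x x

open Graph public

module _ {n : ℕ} (G : Graph n) where

  -- Walk u v ws : the sequence u ∷ ws is a walk from u to v.
  Walk : Fin n → Fin n → List (Fin n) → Set
  Walk u v []       = u ≡ v
  Walk u v (w ∷ ws) = Adj G u w × Walk w v ws

  Connected : Set
  Connected = ∀ u v → ∃ λ ws → Walk u v ws

  Bipartite : Set
  Bipartite = Σ (Fin n → Fin 2) λ c → ∀ x y → Adj G x y → ¬ (c x ≡ c y)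

  -- A cycle: distinct vertices x ∷ rest (at least 3 of them),
  -- consecutive ones adjacent, and the last adjacent to x.
  record Cycle : Set where
    constructor mkCycle
    field
      start   : Fin n
      rest    : List (Fin n)
      long    : 2 ≤ length rest
      distinct : Unique (start ∷ rest)
      closed  : Walk start start (rest ++ start ∷ [])

  open Cycle public

SameEdge : ∀ {n} → Fin n → Fin n → Fin n → Fin n → Set
SameEdge a b c d = (a ≡ c × b ≡ d) ⊎ (a ≡ d × b ≡ c)

EdgeInSeq : ∀ {n} → List (Fin n) → Fin n → Fin n → Set
EdgeInSeq []           a b = ⊥
EdgeInSeq (x ∷ [])     a b = ⊥
EdgeInSeq (x ∷ y ∷ xs) a b = SameEdge x y a b ⊎ EdgeInSeq (y ∷ xs) a b

module _ {n : ℕ} {G : Graph n} where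

  cycleVerts : Cycle G → List (Fin n)
  cycleVerts C = start C ∷ rest C

  CycleEdge : Cycle G → Fin n → Fin n → Set
  CycleEdge C a b = EdgeInSeq (start C ∷ (rest C ++ start C ∷ [])) a b

  SameCycle : Cycle G → Cycle G → Set
  SameCycle C D = ∀ a b → (CycleEdge C a b → CycleEdge D a b) × (CycleEdge D a b → CycleEdge C a b)

module _ {n : ℕ} (G : Graph n) where

  Unicyclic : Set
  Unicyclic = Connected G × Σ (Cycle G) λ C → ∀ D → SameCycle C D

  IsPerfectMatching : (Fin n → Fin n → Set) → Set
  IsPerfectMatching M =
    (∀ x y → M x y → Adj G x y) ×
    (∀ x y → M x y → M y x) ×
    (∀ x → Σ (Fin n) λ y → M x y × (∀ z → M x z → z ≡ y))

  SameRel : (Fin n → Fin n → Set) → (Fin n → Fin n → Set) → Set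
  SameRel M M' = ∀ x y → (M x y → M' x y) × (M' x y → M x y)

  UniquePerfectMatching : (Fin n → Fin n → Set) → Set₁
  UniquePerfectMatching M =
    IsPerfectMatching M × (∀ M' → IsPerfectMatching M' → SameRel M' M)

  Peg : (Fin n → Fin n → Set) → Cycle G → Fin n → Fin n → Set
  Peg M C a b = M a b × ¬ CycleEdge C a b × (a ∈ cycleVerts C ⊎ b ∈ cycleVerts C)

  -- CoAug M u v ws : u ∷ ws is a walk from u to v whose edges alternate
  -- M, non-M, M, …, with first and last edges in M.
  CoAug : (Fin n → Fin n → Set) → Fin n → Fin n → List (Fin n) → Set
  CoAug M u v []           = ⊥
  CoAug M u v (w ∷ [])     = M u w × w ≡ v
  CoAug M u v (w ∷ x ∷ ws) = M u w × Adj G w x × ¬ M w x × CoAug M x v ws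

  CoAugPath : (Fin n → Fin n → Set) → Fin n → Fin n → List (Fin n) → Set
  CoAugPath M u v ws = CoAug M u v ws × Unique (u ∷ ws)

{-# OPTIONS --safe #-}
-- Follow the two paths from u. Their matching edges are forced, since every vertex has exactly
-- one mate, so the paths first separate at a vertex x entered along a matching edge m x and left
-- along two different non-matching edges. Both continuations from x reach v, so they close a
-- cycle through x that avoids m; the graph having only one cycle, x lies on it while m x is not
-- one of its edges, i.e. m x is a peg lying on both paths. The same argument from v along the
-- reversed paths gives a second such peg, and since the paths repeat no vertex the two are
-- different edges, hence they are ρ₁ and ρ₂.
module Submission where

open import Defs
open import Data.Nat using (ℕ; _≤_; s≤s; z≤n)
open import Data.Fin using (Fin; _≟_)
open import Data.List using (List; []; _∷_; _++_; [_]; length; reverse)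
open import Data.List.Properties
  using (∷-injective; ++-assoc; reverse-++; reverse-involutive; reverse-injective; length-reverse)
open import Data.List.Membership.Propositional using (_∈_; _∉_)
open import Data.List.Membership.Propositional.Properties using (∈-++⁺ˡ; ∈-++⁻; ∈-insert; ∈-∃++)
import Data.List.Membership.DecPropositional as DecMembership
open import Data.List.Membership.Setoid.Properties using (∉⇒All[≉])
open import Data.List.Relation.Unary.Any as Any using (Any; here; there)
open import Data.List.Relation.Unary.Any.Properties using (reverse⁻)
open import Data.List.Relation.Unary.All as All using (All)
open import Data.List.Relation.Unary.All.Properties using (++⁻ˡ; ++⁻ʳ; All¬⇒¬Any)
open import Data.List.Relation.Unary.AllPairs using ([]; _∷_)
import Data.List.Relation.Unary.First as First
open import Data.List.Relation.Unary.First.Properties using (cofirst?; toView; ¬First⇒All)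
open import Data.List.Relation.Unary.Unique.Propositional using (Unique)
open import Data.List.Relation.Unary.Unique.Propositional.Properties using (++⁺; Unique[x∷xs]⇒x∉xs)
open import Data.List.Relation.Binary.Disjoint.Propositional using (Disjoint)
import Data.List.Relation.Binary.Permutation.Setoid as Perm
import Data.List.Relation.Binary.Permutation.Setoid.Properties as Perm
open import Data.Product using (Σ; ∃; ∃₂; _×_; _,_; proj₁; proj₂)
open import Data.Sum as Sum using (_⊎_; inj₁; inj₂; [_,_]′)
open import Data.Empty using (⊥-elim)
open import Function using (_∘_; id)
open import Relation.Nullary using (¬_; yes; no)
open import Relation.Binary.Definitions using (DecidableEquality)
open import Relation.Binary.PropositionalEquality
  using (_≡_; _≢_; refl; sym; trans; cong; subst; setoid; module ≡-Reasoning)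

module _ {A : Set} where

  Unique-∷ : ∀ {x : A} {xs} → x ∉ xs → Unique xs → Unique (x ∷ xs)
  Unique-∷ x∉ u = ∉⇒All[≉] (setoid A) x∉ ∷ u

  Unique-++⁻ : ∀ (xs : List A) {ys} → Unique (xs ++ ys) → Unique xs × Unique ys × Disjoint xs ys
  Unique-++⁻ []       u          = [] , u , λ ()
  Unique-++⁻ (x ∷ xs) (x≢ ∷ u) with Unique-++⁻ xs u
  ... | uxs , uys , xs#ys = ++⁻ˡ xs x≢ ∷ uxs , uys , λ where
    (here refl  , v∈ys) → All.lookup (++⁻ʳ xs x≢) v∈ys refl
    (there v∈xs , v∈ys) → xs#ys (v∈xs , v∈ys)

  Unique-drop : ∀ (xs : List A) {ys} → Unique (xs ++ ys) → Unique ys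
  Unique-drop xs = proj₁ ∘ proj₂ ∘ Unique-++⁻ xs

  Unique-reverse : ∀ {xs : List A} → Unique xs → Unique (reverse xs)
  Unique-reverse {xs} =
    Perm.Unique-resp-↭ (setoid A) (Perm.↭-sym (setoid A) (Perm.↭-reverse (setoid A) xs))

  Unique-split : ∀ (xs xs′ : List A) {z ys ys′} → Unique (xs ++ z ∷ ys) →
                 xs ++ z ∷ ys ≡ xs′ ++ z ∷ ys′ → xs ≡ xs′ × ys ≡ ys′
  Unique-split []       []        u        eq = refl , proj₂ (∷-injective eq)
  Unique-split []       (_ ∷ xs′) (z≢ ∷ _) eq with refl , refl ← ∷-injective eq =
    ⊥-elim (All.lookup z≢ (∈-insert xs′) refl)
  Unique-split (_ ∷ xs) []        (z≢ ∷ _) eq with refl , _ ← ∷-injective eq =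
    ⊥-elim (All.lookup z≢ (∈-insert xs) refl)
  Unique-split (_ ∷ xs) (_ ∷ xs′) (_ ∷ u)  eq
    with refl , eq′ ← ∷-injective eq
    with refl , refl ← Unique-split xs xs′ u eq′ = refl , refl

  Unique⇒¬swapped : ∀ (xs xs′ : List A) {a b ys ys′} → Unique (xs ++ a ∷ b ∷ ys) →
                    xs ++ a ∷ b ∷ ys ≢ xs′ ++ b ∷ a ∷ ys′
  Unique⇒¬swapped xs xs′ {a} {b} u eq
    with refl , _ ← Unique-split xs (xs′ ++ [ b ]) u (trans eq (sym (++-assoc xs′ [ b ] (a ∷ _)))) =
    proj₂ (proj₂ (Unique-++⁻ (xs′ ++ [ b ]) u)) (∈-insert xs′ , there (here refl))

  reverse-split : ∀ {xs : List A} ys {a b} zs → reverse xs ≡ ys ++ a ∷ b ∷ zs →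
                  xs ≡ reverse zs ++ b ∷ a ∷ reverse ys
  reverse-split {xs} ys {a} {b} zs eq = begin
    xs                                       ≡⟨ reverse-involutive xs ⟨
    reverse (reverse xs)                     ≡⟨ cong reverse eq ⟩
    reverse (ys ++ a ∷ b ∷ zs)               ≡⟨ reverse-++ ys (a ∷ b ∷ zs) ⟩
    reverse (a ∷ b ∷ zs) ++ reverse ys       ≡⟨ cong (_++ reverse ys) (reverse-++ (a ∷ b ∷ []) zs) ⟩
    (reverse zs ++ b ∷ a ∷ []) ++ reverse ys ≡⟨ ++-assoc (reverse zs) (b ∷ a ∷ []) (reverse ys) ⟩
    reverse zs ++ b ∷ a ∷ reverse ys         ∎
    where open ≡-Reasoning

  ∈-unclose : ∀ {z s : A} rs → z ∈ s ∷ (rs ++ [ s ]) → z ∈ s ∷ rs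
  ∈-unclose rs (here z≡s)  = here z≡s
  ∈-unclose rs (there z∈) = [ there , (λ { (here z≡s) → here z≡s }) ]′ (∈-++⁻ rs z∈)

  -- x ∷ R ++ y ∷ reverse S is the cycle glued from two branches x ∷ R ++ y ∷ _ and x ∷ S ++ y ∷ _
  -- that meet for the first time at y.
  ∈-glued : ∀ {z y : A} R S {L K} → z ∈ R ++ y ∷ reverse S → z ∈ R ++ y ∷ L ⊎ z ∈ S ++ y ∷ K
  ∈-glued R S z∈ with ∈-++⁻ R z∈
  ... | inj₁ z∈R          = inj₁ (∈-++⁺ˡ z∈R)
  ... | inj₂ (here refl)  = inj₁ (∈-insert R)
  ... | inj₂ (there z∈rS) = inj₂ (∈-++⁺ˡ (reverse⁻ {xs = S} z∈rS))

  Unique-glued : ∀ {x y : A} R S {L K} → Unique (x ∷ R ++ y ∷ L) → Unique (x ∷ S ++ y ∷ K) →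
                 All (_∉ S ++ y ∷ K) R → Unique (x ∷ R ++ y ∷ reverse S)
  Unique-glued {x} {y} R S {K = K} (x≢L ∷ uL) (x≢K ∷ uK) R∉K =
    Unique-∷ x∉ (++⁺ (proj₁ (Unique-++⁻ R uL)) uyS R#yS)
    where
    x∉ : x ∉ R ++ y ∷ reverse S
    x∉ x∈ = [ All¬⇒¬Any x≢L , All¬⇒¬Any x≢K ]′ (∈-glued R S x∈)
    uyS : Unique (y ∷ reverse S)
    uyS = subst Unique (reverse-++ S [ y ])
            (Unique-reverse (proj₁ (Unique-++⁻ (S ++ [ y ])
              (subst Unique (sym (++-assoc S [ y ] K)) uK))))
    R#yS : Disjoint R (y ∷ reverse S)
    R#yS (z∈R , here refl)  = All.lookup R∉K z∈R (∈-insert S)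
    R#yS (z∈R , there z∈rS) = All.lookup R∉K z∈R (∈-++⁺ˡ (reverse⁻ {xs = S} z∈rS))

  2≤length-glued : ∀ {p q y : A} R S {ps qs L K} → p ∷ ps ≡ R ++ y ∷ L → q ∷ qs ≡ S ++ y ∷ K →
                   p ≢ q → 2 ≤ length (R ++ y ∷ reverse S)
  2≤length-glued (_ ∷ [])    _        _    _    _   = s≤s (s≤s z≤n)
  2≤length-glued (_ ∷ _ ∷ _) _        _    _    _   = s≤s (s≤s z≤n)
  2≤length-glued []          (s ∷ S)  _    _    _   =
    s≤s (subst (1 ≤_) (sym (length-reverse (s ∷ S))) (s≤s z≤n))
  2≤length-glued []          []       refl refl p≢q = ⊥-elim (p≢q refl)

  split-at-first-∈ : DecidableEquality A → ∀ {xs ys : List A} → Any (_∈ ys) xs →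
                     ∃₂ λ R y → ∃ λ xs₂ → xs ≡ R ++ y ∷ xs₂ × All (_∉ ys) R × y ∈ ys
  split-at-first-∈ _≟_ {xs} {ys} any with cofirst? (λ x → DecMembership._∈?_ _≟_ x ys) xs
  ... | yes f with toView f
  ...   | First._++_∷_ R∉ y∈ xs₂ = _ , _ , xs₂ , refl , R∉ , y∈
  split-at-first-∈ _ any | no ¬f = ⊥-elim (All¬⇒¬Any (¬First⇒All id ¬f) any)

record Fork {A : Set} (_~_ : A → A → Set) (L K : List A) : Set where
  constructor mkFork
  field
    stem           : List A
    mate pivot p q : A
    L′ K′          : List A
    L-split        : L ≡ stem ++ mate ∷ pivot ∷ p ∷ L′
    K-split        : K ≡ stem ++ mate ∷ pivot ∷ q ∷ K′
    p≢q            : p ≢ q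
    mate~pivot     : mate ~ pivot

open Fork

Fork-∷ : ∀ {A : Set} {_~_ : A → A → Set} {L K z} → Fork _~_ L K → Fork _~_ (z ∷ L) (z ∷ K)
Fork-∷ {z = z} (mkFork B s t p q L′ K′ L≡ K≡ p≢q s~t) =
  mkFork (z ∷ B) s t p q L′ K′ (cong (z ∷_) L≡) (cong (z ∷_) K≡) p≢q s~t

module _ {n : ℕ} where

  SameEdge-sym : {a b c d : Fin n} → SameEdge a b c d → SameEdge c d a b
  SameEdge-sym (inj₁ (refl , refl)) = inj₁ (refl , refl)
  SameEdge-sym (inj₂ (refl , refl)) = inj₂ (refl , refl)

  SameEdge-trans : {a b c d e f : Fin n} → SameEdge a b c d → SameEdge c d e f → SameEdge a b e f
  SameEdge-trans (inj₁ (refl , refl)) s                    = s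
  SameEdge-trans (inj₂ (refl , refl)) (inj₁ (refl , refl)) = inj₂ (refl , refl)
  SameEdge-trans (inj₂ (refl , refl)) (inj₂ (refl , refl)) = inj₁ (refl , refl)

  EdgeInSeq-at : ∀ (xs : List (Fin n)) {ys a b zs} → ys ≡ xs ++ a ∷ b ∷ zs → EdgeInSeq ys a b
  EdgeInSeq-at []           refl = inj₁ (inj₁ (refl , refl))
  EdgeInSeq-at (_ ∷ [])     refl = inj₂ (EdgeInSeq-at [] refl)
  EdgeInSeq-at (_ ∷ y ∷ xs) refl = inj₂ (EdgeInSeq-at (y ∷ xs) refl)

  EdgeInSeq-swap : ∀ (xs : List (Fin n)) {a b} → EdgeInSeq xs a b → EdgeInSeq xs b a
  EdgeInSeq-swap (_ ∷ _ ∷ _)  (inj₁ (inj₁ (refl , refl))) = inj₁ (inj₂ (refl , refl))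
  EdgeInSeq-swap (_ ∷ _ ∷ _)  (inj₁ (inj₂ (refl , refl))) = inj₁ (inj₁ (refl , refl))
  EdgeInSeq-swap (_ ∷ y ∷ xs) (inj₂ e)                    = inj₂ (EdgeInSeq-swap (y ∷ xs) e)

  EdgeInSeq-resp : ∀ (xs : List (Fin n)) {a b c d} → SameEdge a b c d →
                   EdgeInSeq xs a b → EdgeInSeq xs c d
  EdgeInSeq-resp xs (inj₁ (refl , refl)) e = e
  EdgeInSeq-resp xs (inj₂ (refl , refl)) e = EdgeInSeq-swap xs e

  EdgeInSeq-endpoints : ∀ (xs : List (Fin n)) {a b} → EdgeInSeq xs a b → a ∈ xs × b ∈ xs
  EdgeInSeq-endpoints (_ ∷ _ ∷ _)  (inj₁ (inj₁ (refl , refl))) = here refl , there (here refl)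
  EdgeInSeq-endpoints (_ ∷ _ ∷ _)  (inj₁ (inj₂ (refl , refl))) = there (here refl) , here refl
  EdgeInSeq-endpoints (_ ∷ y ∷ xs) (inj₂ e) with a∈ , b∈ ← EdgeInSeq-endpoints (y ∷ xs) e =
    there a∈ , there b∈

  EdgeInSeq-exhaust : ∀ (xs : List (Fin n)) {a b c d a₁ b₁ a₂ b₂} → ¬ SameEdge a b c d →
    SameEdge a b a₁ b₁ ⊎ SameEdge a b a₂ b₂ → SameEdge c d a₁ b₁ ⊎ SameEdge c d a₂ b₂ →
    EdgeInSeq xs a b → EdgeInSeq xs c d → EdgeInSeq xs a₁ b₁ × EdgeInSeq xs a₂ b₂
  EdgeInSeq-exhaust xs _     (inj₁ ab) (inj₂ cd) e e′ = EdgeInSeq-resp xs ab e , EdgeInSeq-resp xs cd e′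
  EdgeInSeq-exhaust xs _     (inj₂ ab) (inj₁ cd) e e′ = EdgeInSeq-resp xs cd e′ , EdgeInSeq-resp xs ab e
  EdgeInSeq-exhaust xs apart (inj₁ ab) (inj₁ cd) _ _ = ⊥-elim (apart (SameEdge-trans ab (SameEdge-sym cd)))
  EdgeInSeq-exhaust xs apart (inj₂ ab) (inj₂ cd) _ _ = ⊥-elim (apart (SameEdge-trans ab (SameEdge-sym cd)))

  Fork-edges : ∀ {_~_ : Fin n → Fin n → Set} {L K} (F : Fork _~_ L K) →
    EdgeInSeq L (pivot F) (mate F) × EdgeInSeq K (pivot F) (mate F)
  Fork-edges {L = L} {K} F =
    EdgeInSeq-swap L (EdgeInSeq-at (stem F) (L-split F)) ,
    EdgeInSeq-swap K (EdgeInSeq-at (stem F) (K-split F))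

  module _ {_≈_ : Fin n → Fin n → Set} {L K L₀ K₀ : List (Fin n)}
           (revL : reverse L ≡ L₀) (revK : reverse K ≡ K₀) where

    Fork-edges-reverse : (F : Fork _≈_ L₀ K₀) →
      EdgeInSeq L (pivot F) (mate F) × EdgeInSeq K (pivot F) (mate F)
    Fork-edges-reverse F =
      EdgeInSeq-at (reverse (p F ∷ L′ F))
        (reverse-split (stem F) (p F ∷ L′ F) (trans revL (L-split F))) ,
      EdgeInSeq-at (reverse (q F ∷ K′ F))
        (reverse-split (stem F) (q F ∷ K′ F) (trans revK (K-split F)))

    forks-distinct : ∀ {_~_ : Fin n → Fin n → Set} → Unique L → Unique K →
      (F : Fork _~_ L K) (F′ : Fork _≈_ L₀ K₀) → ¬ SameEdge (pivot F) (mate F) (pivot F′) (mate F′)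
    forks-distinct uL uK (mkFork B _ _ _ _ _ _ refl refl _ _) (mkFork B′ _ _ p′ _ L₁′ _ eL _ _ _)
                   (inj₁ (refl , refl)) =
      Unique⇒¬swapped B (reverse (p′ ∷ L₁′)) uL (reverse-split B′ (p′ ∷ L₁′) (trans revL eL))
    forks-distinct uL uK (mkFork B _ _ _ _ _ _ refl refl p≢q _)
                   (mkFork B′ _ _ p′ q′ L₁′ K₁′ eL eK _ _) (inj₂ (refl , refl))
      with _ , tailL ← Unique-split B (reverse (p′ ∷ L₁′)) uL
                         (reverse-split B′ (p′ ∷ L₁′) (trans revL eL))
         | _ , tailK ← Unique-split B (reverse (q′ ∷ K₁′)) uK
                         (reverse-split B′ (q′ ∷ K₁′) (trans revK eK)) =
      p≢q (proj₁ (∷-injective (proj₂ (∷-injective (trans tailL (sym tailK))))))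

module _ {n : ℕ} (G : Graph n) where

  walk-++ : ∀ {x y z} ws {zs} → Walk G x y ws → Walk G y z zs → Walk G x z (ws ++ zs)
  walk-++ []       refl     w′ = w′
  walk-++ (_ ∷ ws) (e , w) w′ = e , walk-++ ws w w′

  walk-prefix : ∀ {x y v} ws {zs} → Walk G x v (ws ++ y ∷ zs) → Walk G x y (ws ++ [ y ])
  walk-prefix []       (e , _) = e , refl
  walk-prefix (_ ∷ ws) (e , w) = e , walk-prefix ws w

  walk-suffix : ∀ {x y v ws} zs {ys} → x ∷ ws ≡ zs ++ y ∷ ys → Walk G x v ws → Walk G y v ys
  walk-suffix               []          refl w       = w
  walk-suffix {ws = _ ∷ _} (_ ∷ zs)    eq   (_ , w) = walk-suffix zs (proj₂ (∷-injective eq)) w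
  walk-suffix {ws = []}    (_ ∷ [])    ()
  walk-suffix {ws = []}    (_ ∷ _ ∷ _) ()

  walk-reverse : ∀ {x y} ws → Walk G x y (ws ++ [ y ]) → Walk G y x (reverse ws ++ [ x ])
  walk-reverse []       (e , refl) = Adj-sym G e , refl
  walk-reverse (w ∷ ws) (e , walk) rewrite reverse-++ [ w ] ws =
    walk-++ (reverse ws ++ [ w ]) (walk-reverse ws walk) (Adj-sym G e , refl)

  walk-end : ∀ {x v} ws → Walk G x v ws → v ∈ x ∷ ws
  walk-end []       refl     = here refl
  walk-end (_ ∷ ws) (_ , w) = there (walk-end ws w)

  walk-close : ∀ {x y} R S → Walk G x y (R ++ [ y ]) → Walk G x y (S ++ [ y ]) →
               Walk G x x ((R ++ y ∷ reverse S) ++ [ x ])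
  walk-close {x} {y} R S wR wS =
    subst (Walk G x x) (trans (++-assoc R [ y ] _) (sym (++-assoc R (y ∷ reverse S) [ x ])))
      (walk-++ (R ++ [ y ]) wR (walk-reverse S wS))

  cycleEdge-start : (C : Cycle G) → ∃ (CycleEdge C (start C))
  cycleEdge-start (mkCycle _ (_ ∷ _) _ _ _) = _ , inj₁ (inj₁ (refl , refl))

  cycleEdge-endpoints : (C : Cycle G) {a b : Fin n} → CycleEdge C a b →
                        a ∈ cycleVerts C × b ∈ cycleVerts C
  cycleEdge-endpoints C e with a∈ , b∈ ← EdgeInSeq-endpoints (start C ∷ (rest C ++ [ start C ])) e =
    ∈-unclose (rest C) a∈ , ∈-unclose (rest C) b∈

  unicyclic-edge : Unicyclic G → (C Z : Cycle G) {a b : Fin n} → CycleEdge C a b → CycleEdge Z a b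
  unicyclic-edge (_ , _ , same) C Z {a} {b} e = proj₁ (same Z a b) (proj₂ (same C a b) e)

  fork-cycle : ∀ {x v p q ps qs} → Walk G x v (p ∷ ps) → Walk G x v (q ∷ qs) →
    Unique (x ∷ p ∷ ps) → Unique (x ∷ q ∷ qs) → p ≢ q →
    Σ (Cycle G) λ Z → start Z ≡ x × (∀ {z} → z ∈ rest Z → z ∈ p ∷ ps ⊎ z ∈ q ∷ qs)
  fork-cycle {x} {v} {ps = ps} {qs} wL wK uL uK p≢q
    with R , y , _ , L≡ , R∉K , y∈K ←
           split-at-first-∈ _≟_
             (Any.map (λ { refl → walk-end qs (proj₂ wK) }) (walk-end ps (proj₂ wL)))
    with S , _ , K≡ ← ∈-∃++ y∈K =
    mkCycle x (R ++ y ∷ reverse S) (2≤length-glued R S L≡ K≡ p≢q) unique round-trip ,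
    refl ,
    Sum.map (subst (_ ∈_) (sym L≡)) (subst (_ ∈_) (sym K≡)) ∘ ∈-glued R S
    where
    unique : Unique (x ∷ R ++ y ∷ reverse S)
    unique = Unique-glued R S (subst (Unique ∘ (x ∷_)) L≡ uL) (subst (Unique ∘ (x ∷_)) K≡ uK)
               (subst (λ K → All (_∉ K) R) K≡ R∉K)
    round-trip : Walk G x x ((R ++ y ∷ reverse S) ++ [ x ])
    round-trip = walk-close R S (walk-prefix R (subst (Walk G x v) L≡ wL))
                                (walk-prefix S (subst (Walk G x v) K≡ wK))

  fork-on-cycle : Unicyclic G → (C : Cycle G) → ∀ {m x v p q ps qs} →
    Walk G x v (p ∷ ps) → Walk G x v (q ∷ qs) →
    Unique (m ∷ x ∷ p ∷ ps) → Unique (m ∷ x ∷ q ∷ qs) → p ≢ q →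
    x ∈ cycleVerts C × ¬ CycleEdge C x m
  fork-on-cycle U C {m} wL wK uL@(_ ∷ uL′) uK@(_ ∷ uK′) p≢q
    with Z , refl , Z⊆ ← fork-cycle wL wK uL′ uK′ p≢q =
    proj₁ (cycleEdge-endpoints C (unicyclic-edge U Z C (proj₂ (cycleEdge-start Z)))) , ¬edge
    where
    ¬edge : ¬ CycleEdge C (start Z) m
    ¬edge e with proj₂ (cycleEdge-endpoints Z (unicyclic-edge U C Z e))
    ... | here refl = Unique[x∷xs]⇒x∉xs uL (here refl)
    ... | there m∈  = [ Unique[x∷xs]⇒x∉xs uL ∘ there , Unique[x∷xs]⇒x∉xs uK ∘ there ]′ (Z⊆ m∈)

  module _ {M : Fin n → Fin n → Set} (PM : IsPerfectMatching G M) where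

    M-sym : ∀ {x y} → M x y → M y x
    M-sym = proj₁ (proj₂ PM) _ _

    M-unique : ∀ {x y z} → M x y → M x z → y ≡ z
    M-unique {x} xy xz with _ , _ , only ← proj₂ (proj₂ PM) x = trans (only _ xy) (sym (only _ xz))

    coAug⇒walk : ∀ {u v} ws → CoAug G M u v ws → Walk G u v ws
    coAug⇒walk (_ ∷ [])     (uw , refl)       = proj₁ PM _ _ uw , refl
    coAug⇒walk (_ ∷ _ ∷ ws) (uw , wx , _ , c) = proj₁ PM _ _ uw , wx , coAug⇒walk ws c

    coAug-++ : ∀ {u x y v} ws {zs} → CoAug G M u x ws → Adj G x y → ¬ M x y → CoAug G M y v zs →
               CoAug G M u v (ws ++ y ∷ zs)
    coAug-++ (_ ∷ [])     (uw , refl)         xy ¬xy c′ = uw , xy , ¬xy , c′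
    coAug-++ (_ ∷ _ ∷ ws) (uw , wx , ¬wx , c) xy ¬xy c′ = uw , wx , ¬wx , coAug-++ ws c xy ¬xy c′

    coAug-reverse : ∀ {u v} ws → CoAug G M u v ws →
                    ∃ λ rs → reverse (u ∷ ws) ≡ v ∷ rs × CoAug G M v u rs
    coAug-reverse {u} (_ ∷ [])     (uw , refl)         = u ∷ [] , refl , M-sym uw , refl
    coAug-reverse {u} (w ∷ x ∷ ws) (uw , wx , ¬wx , c) with rs , rev≡ , c′ ← coAug-reverse ws c =
      rs ++ w ∷ u ∷ [] ,
      trans (reverse-++ (u ∷ w ∷ []) (x ∷ ws)) (cong (_++ w ∷ u ∷ []) rev≡) ,
      coAug-++ rs c′ (Adj-sym G wx) (¬wx ∘ M-sym) (M-sym uw , refl)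

    coAugPath-reverse : ∀ {u v ws} → CoAugPath G M u v ws →
                        ∃ λ rs → reverse (u ∷ ws) ≡ v ∷ rs × CoAugPath G M v u rs
    coAugPath-reverse {ws = ws} (c , uniq) with rs , rev≡ , c′ ← coAug-reverse ws c =
      rs , rev≡ , c′ , subst Unique rev≡ (Unique-reverse uniq)

    coAug-second≢end : ∀ {u v w x ws} → CoAug G M u v (w ∷ x ∷ ws) → Unique (u ∷ w ∷ x ∷ ws) →
                       w ≢ v
    coAug-second≢end {ws = ws} (_ , _ , _ , c) (_ ∷ w≢ ∷ _) refl =
      All.lookup w≢ (walk-end ws (coAug⇒walk ws c)) refl

    fork : ∀ {u v ps qs} → CoAugPath G M u v ps → CoAugPath G M u v qs → ps ≢ qs →
           Fork M (u ∷ ps) (u ∷ qs)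
    fork {ps = _ ∷ []}    {_ ∷ []}    ((_ , refl) , _) ((_ , refl) , _) ps≢qs = ⊥-elim (ps≢qs refl)
    fork {ps = _ ∷ []}    {_ ∷ _ ∷ _} ((uv , refl) , _) (cQ@(uw , _) , uQ) _ =
      ⊥-elim (coAug-second≢end cQ uQ (sym (M-unique uv uw)))
    fork {ps = _ ∷ _ ∷ _} {_ ∷ []}    (cP@(uw , _) , uP) ((uv , refl) , _) _ =
      ⊥-elim (coAug-second≢end cP uP (M-unique uw uv))
    fork {u} {ps = w ∷ x ∷ ps} {_ ∷ x′ ∷ qs}
         ((uw , _ , _ , c) , _ ∷ _ ∷ uP) ((uw′ , _ , _ , c′) , _ ∷ _ ∷ uQ) ps≢qs
      with refl ← M-unique uw uw′ | x ≟ x′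
    ... | yes refl = Fork-∷ (Fork-∷ (fork (c , uP) (c′ , uQ) (ps≢qs ∘ cong (λ t → w ∷ x ∷ t))))
    ... | no x≢x′  = mkFork [] u w x x′ ps qs refl refl x≢x′ uw

    fork-peg : Unicyclic G → (C : Cycle G) → ∀ {u v ps qs} →
               CoAugPath G M u v ps → CoAugPath G M u v qs → (F : Fork M (u ∷ ps) (u ∷ qs)) →
               Peg G M C (pivot F) (mate F)
    fork-peg U C {u} {v} (cP , uP) (cQ , uQ) F =
      M-sym (mate~pivot F) , proj₂ pivot-on-C , inj₁ (proj₁ pivot-on-C)
      where
      branch-walk : ∀ {ws y ys} → CoAug G M u v ws →
                    u ∷ ws ≡ stem F ++ mate F ∷ pivot F ∷ y ∷ ys → Walk G (pivot F) v (y ∷ ys)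
      branch-walk {ws} c eq = proj₂ (walk-suffix (stem F) eq (coAug⇒walk ws c))
      pivot-on-C : pivot F ∈ cycleVerts C × ¬ CycleEdge C (pivot F) (mate F)
      pivot-on-C = fork-on-cycle U C (branch-walk cP (L-split F)) (branch-walk cQ (K-split F))
                     (Unique-drop (stem F) (subst Unique (L-split F) uP))
                     (Unique-drop (stem F) (subst Unique (K-split F) uQ)) (p≢q F)

theorem11 : (n : ℕ) (D : Graph n) → Bipartite D → Unicyclic D →
    (M : Fin n → Fin n → Set) → UniquePerfectMatching D M →
    (C : Cycle D) →
    (a₁ b₁ a₂ b₂ : Fin n) →
    Peg D M C a₁ b₁ → Peg D M C a₂ b₂ → ¬ SameEdge a₁ b₁ a₂ b₂ →
    (∀ a b → Peg D M C a b → SameEdge a b a₁ b₁ ⊎ SameEdge a b a₂ b₂) →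
    (u v : Fin n) (ps qs : List (Fin n)) →
    CoAugPath D M u v ps → CoAugPath D M u v qs → ps ≢ qs →
    (EdgeInSeq (u ∷ ps) a₁ b₁ × EdgeInSeq (u ∷ ps) a₂ b₂) ×
    (EdgeInSeq (u ∷ qs) a₁ b₁ × EdgeInSeq (u ∷ qs) a₂ b₂)
theorem11 n D _ U M (PM , _) C a₁ b₁ a₂ b₂ _ _ _ two-pegs u v ps qs P Q ps≢qs
  with rs , revP , P′ ← coAugPath-reverse D PM P
     | rs′ , revQ , Q′ ← coAugPath-reverse D PM Q =
  covers (u ∷ ps) (proj₁ (Fork-edges F)) (proj₁ backward) ,
  covers (u ∷ qs) (proj₂ (Fork-edges F)) (proj₂ backward)
  where
  F : Fork M (u ∷ ps) (u ∷ qs)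
  F = fork D PM P Q ps≢qs
  rs≢rs′ : rs ≢ rs′
  rs≢rs′ refl = ps≢qs (proj₂ (∷-injective (reverse-injective (trans revP (sym revQ)))))
  F′ : Fork M (v ∷ rs) (v ∷ rs′)
  F′ = fork D PM P′ Q′ rs≢rs′
  backward : EdgeInSeq (u ∷ ps) (pivot F′) (mate F′) × EdgeInSeq (u ∷ qs) (pivot F′) (mate F′)
  backward = Fork-edges-reverse revP revQ F′
  covers : ∀ xs → EdgeInSeq xs (pivot F) (mate F) → EdgeInSeq xs (pivot F′) (mate F′) →
           EdgeInSeq xs a₁ b₁ × EdgeInSeq xs a₂ b₂
  covers xs = EdgeInSeq-exhaust xs (forks-distinct revP revQ (proj₂ P) (proj₂ Q) F F′)
                (two-pegs _ _ (fork-peg D PM U C P Q F)) (two-pegs _ _ (fork-peg D PM U C P′ Q′ F′))
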